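{- Let $G$ be a graph and $f$ a token-placement of $G$ using colors $\{1,2\}$. Let $P=\langle p_1,p_2,\dots,p_q\rangle$ be a shortest path in $G$ between $p_1$ and $p_q$, of length $w=q-1$. Suppose $f(p_1)\ne f(p_q)$. Then there is a sequence of $w$ swaps (each along an edge of $G$) transforming $f$ into the token-placement $g$ with $g(p_1)=f(p_q)$, $g(p_q)=f(p_1)$ and $g(v)=f(v)$ for every other vertex $v$ (in particular, the color on each internal vertex of $P$ is unchanged).
   Context: $G=(V,E)$ is a finite simple undirected graph. A token-placement is a surjective map $f\colon V\to\{1,2\}$. A swap along an edge $(u,v)\in E$ exchanges the values of the placement at $u$ and $v$ and leaves all other values unchanged. -}

module Defs where

open import Data.Nat using (ℕ; zero; suc; _<_)
open import Data.Fin using (Fin; zero; suc; fromℕ; _≟_)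
open import Data.List using (List; []; _∷_; length; foldl)
open import Data.List.Relation.Unary.All using (All)
open import Data.Product using (_×_; Σ; ∃; _,_)
open import Relation.Binary.PropositionalEquality using (_≡_; _≢_)
open import Relation.Nullary using (¬_; yes; no)
open import Function.Definitions using (Injective; Surjective)

record SimpleGraph (n : ℕ) : Set₁ where
  field
    Adj     : Fin n → Fin n → Set
    sym     : ∀ {u v} → Adj u v → Adj v u
    irrefl  : ∀ {v} → ¬ Adj v v
open SimpleGraph public

-- The two colours {1,2}, as Fin 2 (zero ↦ 1, suc zero ↦ 2).
Color : Set
Color = Fin 2

Placement : ℕ → Set
Placement n = Fin n → Color

IsTokenPlacement : ∀ {n} → Placement n → Set
IsTokenPlacement f = Surjective _≡_ _≡_ f

swap : ∀ {n} → Placement n → Fin n → Fin n → Placement n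
swap f u v x with x ≟ u
... | yes _ = f v
... | no _ with x ≟ v
...   | yes _ = f u
...   | no _ = f x

applySwaps : ∀ {n} → Placement n → List (Fin n × Fin n) → Placement n
applySwaps f ss = foldl (λ h e → swap h (Data.Product.proj₁ e) (Data.Product.proj₂ e)) f ss

AllEdges : ∀ {n} → SimpleGraph n → List (Fin n × Fin n) → Set
AllEdges G ss = All (λ e → Adj G (Data.Product.proj₁ e) (Data.Product.proj₂ e)) ss

data Walk {n} (G : SimpleGraph n) : Fin n → Fin n → ℕ → Set where
  here : ∀ {v} → Walk G v v zero
  step : ∀ {u v w k} → Adj G u v → Walk G v w k → Walk G u w (suc k)

-- p : Fin (suc w) → Fin n is a path <p_1,...,p_q> (q = w+1) of length w in G.
IsPath : ∀ {n} (G : SimpleGraph n) (w : ℕ) → (Fin (suc w) → Fin n) → Set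
IsPath G w p = Injective _≡_ _≡_ p
             × (∀ (i : Fin w) → Adj G (p (Data.Fin.inject₁ i)) (p (suc i)))

IsShortestPath : ∀ {n} (G : SimpleGraph n) (w : ℕ) → (Fin (suc w) → Fin n) → Set
IsShortestPath G w p = IsPath G w p
  × (∀ k → Walk G (p zero) (p (fromℕ w)) k → ¬ (k < w))

endSwapped : ∀ {n} → Placement n → Fin n → Fin n → Placement n → Set
endSwapped f a b g = (g a ≡ f b) × (g b ≡ f a) × (∀ v → v ≢ a → v ≢ b → g v ≡ f v)

module Submission where

open import Defs hiding (sym)
open import Data.Nat using (ℕ; suc)
open import Data.Nat.Properties using (+-comm)
open import Data.Fin using (Fin; zero; suc; fromℕ; inject₁; _≟_)
open import Data.Fin.Properties using (0≢1+n; suc-injective)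
open import Data.List using (List; []; _∷_; _∷ʳ_; length)
open import Data.List.Properties using (length-++; foldl-∷ʳ)
open import Data.List.Relation.Unary.All using ([]; _∷_)
open import Data.List.Relation.Unary.All.Properties using (∷ʳ⁺)
open import Data.Product using (Σ; _×_; _,_)
open import Function using (_∘_)
open import Function.Definitions using (Injective)
open import Relation.Nullary using (yes; no; contradiction)
open import Relation.Binary.PropositionalEquality
  using (_≡_; _≢_; refl; sym; trans; subst; ≢-sym)

-- Induction along the path a = p₁, c = p₂, …, b = p_q. If f c = f a, first exchange the
-- tokens of c and b along the tail of the path and then swap a and c; otherwise f c = f b,
-- and we swap a and c first and then exchange the tokens of c and b. The order is chosen so
-- that a and c are swapped while they carry different colours, which is what restores the
-- colour of c at the end.

module _ {n : ℕ} where

  swap-endSwapped : ∀ (f : Placement n) {u v} → u ≢ v → endSwapped f u v (swap f u v)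
  swap-endSwapped f {u} {v} u≢v = at-u , at-v , elsewhere
    where
    at-u : swap f u v u ≡ f v
    at-u with u ≟ u
    ... | yes _ = refl
    ... | no u≢u = contradiction refl u≢u

    at-v : swap f u v v ≡ f u
    at-v with v ≟ u
    ... | yes v≡u = contradiction (sym v≡u) u≢v
    ... | no _ with v ≟ v
    ...   | yes _ = refl
    ...   | no v≢v = contradiction refl v≢v

    elsewhere : ∀ x → x ≢ u → x ≢ v → swap f u v x ≡ f x
    elsewhere x x≢u x≢v with x ≟ u
    ... | yes x≡u = contradiction x≡u x≢u
    ... | no _ with x ≟ v
    ...   | yes x≡v = contradiction x≡v x≢v
    ...   | no _ = refl

  endSwapped-comm : ∀ {f g : Placement n} {a b} → endSwapped f a b g → endSwapped f b a g
  endSwapped-comm (ga , gb , rest) = gb , ga , λ v v≢b v≢a → rest v v≢a v≢b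

  endSwapped-trans : ∀ {f g h : Placement n} {a b c} → a ≢ c → a ≢ b → b ≢ c →
                     endSwapped f a c g → endSwapped g c b h → g a ≡ g b →
                     endSwapped f a b h
  endSwapped-trans {f} {g} {h} {a} {b} {c} a≢c a≢b b≢c
                   (ga , gc , g-rest) (hc , hb , h-rest) ga≡gb =
    ha , trans hb gc , elsewhere
    where
    gb : g b ≡ f b
    gb = g-rest b (≢-sym a≢b) b≢c

    ha : h a ≡ f b
    ha = trans (h-rest a a≢c a≢b) (trans ga≡gb gb)

    elsewhere : ∀ v → v ≢ a → v ≢ b → h v ≡ f v
    elsewhere v v≢a v≢b with v ≟ c
    ... | yes refl = trans hc (trans (sym ga≡gb) ga)
    ... | no v≢c = trans (h-rest v v≢c v≢b) (g-rest v v≢a v≢c)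

Color-≢∧≢⇒≡ : ∀ {x y z : Color} → x ≢ y → z ≢ x → z ≡ y
Color-≢∧≢⇒≡ {zero}     {zero}     x≢y _   = contradiction refl x≢y
Color-≢∧≢⇒≡ {zero}     {suc zero} {zero}     _ z≢x = contradiction refl z≢x
Color-≢∧≢⇒≡ {zero}     {suc zero} {suc zero} _ _   = refl
Color-≢∧≢⇒≡ {suc zero} {zero}     {zero}     _ _   = refl
Color-≢∧≢⇒≡ {suc zero} {zero}     {suc zero} _ z≢x = contradiction refl z≢x
Color-≢∧≢⇒≡ {suc zero} {suc zero} x≢y _   = contradiction refl x≢y

injective-zero≢suc : ∀ {n k} {q : Fin (suc k) → Fin n} → Injective _≡_ _≡_ q →
                     ∀ {i} → q zero ≢ q (suc i)
injective-zero≢suc inj q0≡qi = 0≢1+n (inj q0≡qi)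

module _ {n : ℕ} (G : SimpleGraph n) where

  EdgeSwaps : Placement n → ℕ → (Placement n → Set) → Set
  EdgeSwaps f k P = Σ (List (Fin n × Fin n)) (λ ss →
    (length ss ≡ k) × AllEdges G ss × P (applySwaps f ss))

  swap-first : ∀ {f k P u v} → Adj G u v → EdgeSwaps (swap f u v) k P → EdgeSwaps f (suc k) P
  swap-first {u = u} {v} uv (ss , refl , edges , p) = (u , v) ∷ ss , refl , uv ∷ edges , p

  swap-last : ∀ {f k P u v} → Adj G u v → EdgeSwaps f k (λ g → P (swap g u v)) →
              EdgeSwaps f (suc k) P
  swap-last {f} {P = P} {u} {v} uv (ss , refl , edges , p) =
    ss ∷ʳ (u , v) ,
    trans (length-++ ss) (+-comm (length ss) 1) ,
    ∷ʳ⁺ edges uv ,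
    subst P (sym (foldl-∷ʳ _ f (u , v) ss)) p

  EdgeSwaps-map : ∀ {f k} {P Q : Placement n → Set} → (∀ g → P g → Q g) →
                  EdgeSwaps f k P → EdgeSwaps f k Q
  EdgeSwaps-map P⇒Q (ss , len , edges , p) = ss , len , edges , P⇒Q _ p

  endSwaps-extend : ∀ {k a b c} → a ≢ c → a ≢ b → c ≢ b → Adj G a c →
                    (∀ f → f c ≢ f b → EdgeSwaps f k (endSwapped f c b)) →
                    ∀ f → f a ≢ f b → EdgeSwaps f (suc k) (endSwapped f a b)
  endSwaps-extend {a = a} {b} {c} a≢c a≢b c≢b ac endSwaps-cb f fa≢fb with f c ≟ f a
  ... | yes fc≡fa =
    swap-last {P = endSwapped f a b} ac (EdgeSwaps-map finish (endSwaps-cb f fc≢fb))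
    where
    fc≢fb : f c ≢ f b
    fc≢fb fc≡fb = fa≢fb (trans (sym fc≡fa) fc≡fb)

    finish : ∀ g → endSwapped f c b g → endSwapped f a b (swap g a c)
    finish g g-swapped@(_ , gb , g-rest) =
      endSwapped-comm
        (endSwapped-trans (≢-sym c≢b) (≢-sym a≢b) a≢c (endSwapped-comm g-swapped)
          (endSwapped-comm (swap-endSwapped _ a≢c))
          (trans gb (trans fc≡fa (sym (g-rest a a≢c a≢b)))))
  ... | no fc≢fa =
    swap-first {P = endSwapped f a b} ac (EdgeSwaps-map finish (endSwaps-cb (swap f a c) f₁c≢f₁b))
    where
    f₁-swapped : endSwapped f a c (swap f a c)
    f₁-swapped = swap-endSwapped f a≢c

    f₁b : swap f a c b ≡ f b
    f₁b = let (_ , _ , f₁-rest) = f₁-swapped in f₁-rest b (≢-sym a≢b) (≢-sym c≢b)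

    f₁c≢f₁b : swap f a c c ≢ swap f a c b
    f₁c≢f₁b f₁c≡f₁b = let (_ , f₁c , _) = f₁-swapped in
      fa≢fb (trans (sym f₁c) (trans f₁c≡f₁b f₁b))

    finish : ∀ h → endSwapped (swap f a c) c b h → endSwapped f a b h
    finish h h-swapped = let (f₁a , _ , _) = f₁-swapped in
      endSwapped-trans a≢c a≢b (≢-sym c≢b) f₁-swapped h-swapped
        (trans f₁a (trans (Color-≢∧≢⇒≡ fa≢fb fc≢fa) (sym f₁b)))

  path-endSwaps : ∀ k (q : Fin (suc k) → Fin n) → Injective _≡_ _≡_ q →
                  (∀ (i : Fin k) → Adj G (q (inject₁ i)) (q (suc i))) →
                  ∀ f → f (q zero) ≢ f (q (fromℕ k)) →
                  EdgeSwaps f k (endSwapped f (q zero) (q (fromℕ k)))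
  path-endSwaps 0 q inj adj f fa≢fb = contradiction refl fa≢fb
  path-endSwaps 1 q inj adj f fa≢fb =
    swap-first {P = endSwapped f (q zero) (q (suc zero))} (adj zero)
      ([] , refl , [] , swap-endSwapped f (injective-zero≢suc inj))
  path-endSwaps (suc (suc k)) q inj adj =
    endSwaps-extend (injective-zero≢suc inj) (injective-zero≢suc inj)
      (injective-zero≢suc tail-injective) (adj zero)
      (path-endSwaps (suc k) (q ∘ suc) tail-injective (adj ∘ suc))
    where
    tail-injective : Injective _≡_ _≡_ (q ∘ suc)
    tail-injective = suc-injective ∘ inj

lemma2 : ∀ {n : ℕ} (G : SimpleGraph n) (f : Placement n) → IsTokenPlacement f
       → (w : ℕ) (p : Fin (suc w) → Fin n) → IsShortestPath G w p
       → f (p zero) ≢ f (p (fromℕ w))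
       → Σ (List (Fin n × Fin n)) (λ ss →
           (length ss ≡ w) × AllEdges G ss
           × endSwapped f (p zero) (p (fromℕ w)) (applySwaps f ss))
lemma2 G f _ w p ((inj , adj) , _) = path-endSwaps G w p inj adj f
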